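{- Let $a$, $b$ and $d$ be positive integers, where $d$ is not a square, put $\alpha=a+b^{2}\sqrt{d}$ and $N_{\alpha}=a^{2}-b^{4}d$, and suppose $N_{\alpha}<0$. Let $\varepsilon=(t+u\sqrt{d})/2$ be a unit in the ring of integers of $\mathbb{Q}(\sqrt{d})$ with $t,u$ positive integers, and define $(x_k)_{k\in\mathbb{Z}}$, $(y_k)_{k\in\mathbb{Z}}$ by $x_k+y_k\sqrt{d}=\alpha\varepsilon^{2k}$. Assume $b^{2}$ is the smallest integer square among the $y_k$, and let $K$ be the largest negative integer such that $y_K>b^{2}$. If $d>201$ and $d>9.47\,b^{18}/u^{6}$, then for every integer $k$ with $k\geq 3$ or $k\leq K-2$, \[ y_k\geq \frac{64}{15}\,\frac{b^{4}|N_{\alpha}|^{4}}{d^{2}}. \]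
   Context: Here $x_k,y_k$ are rational numbers determined by writing $\alpha\varepsilon^{2k}$ in the basis $1,\sqrt{d}$ of $\mathbb{Q}(\sqrt{d})$. -}

module Defs where

open import Data.Nat using (ℕ)
open import Data.Integer using (ℤ; +_)
open import Data.Rational using (ℚ; _/_; _+_; _*_)
open import Data.Product using (_×_; _,_)

-- Elements x + y √d of ℚ(√d), represented by their coordinates (x , y)
-- in the basis 1, √d.
QD : Set
QD = ℚ × ℚ

ℕ→ℚ : ℕ → ℚ
ℕ→ℚ n = + n / 1

ℤ→ℚ : ℤ → ℚ
ℤ→ℚ z = z / 1

-- multiplication in ℚ(√d):  (x + y√d)(p + q√d) = (xp + d yq) + (xq + yp)√d
mulD : ℕ → QD → QD → QD
mulD d (x , y) (p , q) = (x * p + ℕ→ℚ d * (y * q)) , (x * q + y * p)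

epsD : ℕ → ℕ → QD
epsD t u = (+ t / 2) , (+ u / 2)

open import Data.Nat using (_^_; NonZero)
import Data.Integer as Z

Nα : ℕ → ℕ → ℕ → ℤ
Nα a b d = (+ a Z.* + a) Z.- (+ (b ^ 4) Z.* + d)

bound : (a b d : ℕ) → .{{_ : NonZero d}} → ℚ
bound a b d = (+ 64 / 15) * ℕ→ℚ (b ^ 4 Data.Nat.* (Z.∣ Nα a b d ∣ ^ 4)) * ((+ 1 / d) * (+ 1 / d))

{-# OPTIONS --safe #-}
module Submission where

-- Multiplication by η = ε² (norm 1, trace T = (t² + u²d)/2) turns (y_k) into a solution of
-- y_{k+1} = T y_k − y_{k−1} and preserves d y_k² − x_k² = |N_α| =: n; eliminating x_k gives
-- (T² − 4) n = 4d (T y_k y_{k+1} − y_k² − y_{k+1}²) for consecutive terms.  The pairs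
-- (y_0, y_1) and (y_{K+1}, y_K) are of the form (Y, X) with Y ≤ b² ≤ X, and the recurrence
-- increases away from them, so y_k ≥ (T² − 1)X − TY for k ≥ 3 and for k ≤ K − 2.  For such a
-- pair T X Y − X² − Y² ≤ X (T b² − X), and AM-GM bounds X³ (T b² − X)⁴ by 3³4⁴/7⁷ (T b²)⁷.
-- Together with 947 b¹⁸ d² < 100 (u²d)³ ≤ 100 (T + 2)³ and T ≥ 218 (which d > 201 forces)
-- this is a polynomial inequality in T.

module NatFacts where

  open import Data.Nat
  open import Data.Nat.Properties
  open import Data.Product using (_×_; _,_)
  open import Data.Sum using (_⊎_; inj₁; inj₂)
  open import Relation.Binary.PropositionalEquality using (_≡_; refl; sym; subst)
  open import Relation.Nullary using (yes; no; contradiction)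
  open import Relation.Nullary.Decidable using (from-no)
  open import Data.Nat.Solver using (module +-*-Solver)
  open +-*-Solver

  differ-by-4 : ∀ {s w} → s ≡ w + 4 ⊎ s + 4 ≡ w → w ≤ s + 4 × s ≤ w + 4
  differ-by-4 {w = w} (inj₁ refl) = ≤-trans (m≤m+n w 4) (m≤m+n (w + 4) 4) , ≤-refl
  differ-by-4 {s} (inj₂ refl) = ≤-refl , ≤-trans (m≤m+n s 4) (m≤m+n (s + 4) 4)

  198≤t²⇒15≤t : ∀ t → 198 ≤ t * t → 15 ≤ t
  198≤t²⇒15≤t t 198≤t² with 15 ≤? t
  ... | yes 15≤t = 15≤t
  ... | no 15≰t = contradiction (≤-trans 198≤t² (*-mono-≤ t≤14 t≤14)) (from-no (198 ≤? 14 * 14))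
    where t≤14 = ≤-pred (≰⇒> 15≰t)

  436≤t²+w : ∀ t w → 202 ≤ w → w ≤ t * t + 4 → t * t ≤ w + 4 → 436 ≤ t * t + w
  436≤t²+w t w 202≤w w≤t²+4 t²≤w+4 = ≤-trans (m≤m+n 436 10) (+-mono-≤ 225≤t² 221≤w)
    where
    225≤t² : 225 ≤ t * t
    225≤t² = *-mono-≤ 15≤t 15≤t
      where 15≤t = 198≤t²⇒15≤t t (+-cancelʳ-≤ 4 198 (t * t) (≤-trans 202≤w w≤t²+4))
    221≤w : 221 ≤ w
    221≤w = +-cancelʳ-≤ 4 221 w (≤-trans 225≤t² t²≤w+4)

  trace-bounds : ∀ d t u .{{_ : NonZero u}} → 201 < d → t * t ≡ u * u * d + 4 ⊎ t * t + 4 ≡ u * u * d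
    → 436 ≤ t * t + u * u * d × u * u * d ≤ t * t + 4
  trace-bounds d t u 201<d unit with differ-by-4 unit
  ... | w≤t²+4 , t²≤w+4 = 436≤t²+w t (u * u * d) 202≤w w≤t²+4 t²≤w+4 , w≤t²+4
    where 202≤w = ≤-trans 201<d (m≤n*m d (u * u) {{m*n≢0 u u}})

  cube-condition : ∀ b d u → 947 * b ^ 18 < 100 * d * u ^ 6 → 947 * (b ^ 2) ^ 9 * d ^ 2 ≤ 100 * (u * u * d) ^ 3
  cube-condition b d u small-b = subst (λ e → 947 * e * d ^ 2 ≤ 100 * (u * u * d) ^ 3) (sym (^-*-assoc b 2 9))
    (subst (947 * b ^ 18 * d ^ 2 ≤_)
      (solve 2 (λ d u → con 100 :* d :* u :^ 6 :* d :^ 2 := con 100 :* (u :* u :* d) :^ 3) refl d u)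
      (*-monoˡ-≤ (d ^ 2) (<⇒≤ small-b)))

module IntFacts where

  open import Data.Nat using (_+_; _*_; _^_; _∸_)
  open import Data.Nat.Properties using (m+[n∸m]≡n)
  open import Data.Integer as ℤ using (ℤ; +_; -[1+_]; ∣_∣)
  open import Data.Product using (∃-syntax; _,_)
  import Data.Integer.Properties as ℤ
  open import Data.Integer.Solver using (module +-*-Solver)
  open +-*-Solver
  open import Relation.Binary.PropositionalEquality using (_≡_; refl; sym; cong; cong₂; module ≡-Reasoning)
  open import Defs using (Nα)

  i<0⇒+∣i∣≡-i : ∀ {i} → i ℤ.< + 0 → + ∣ i ∣ ≡ ℤ.- i
  i<0⇒+∣i∣≡-i { -[1+ n ]} _ = refl
  i<0⇒+∣i∣≡-i {+ n} (ℤ.+<+ ())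

  ∣Nα∣+a²≡b⁴d : ∀ a b d → Nα a b d ℤ.< + 0 → ∣ Nα a b d ∣ + a * a ≡ b ^ 4 * d
  ∣Nα∣+a²≡b⁴d a b d Nα<0 = ℤ.+-injective (begin
    + (∣ Nα a b d ∣ + a * a)      ≡⟨ ℤ.pos-+ ∣ Nα a b d ∣ (a * a) ⟩
    + ∣ Nα a b d ∣ ℤ.+ + (a * a)  ≡⟨ cong₂ ℤ._+_ (i<0⇒+∣i∣≡-i Nα<0) (ℤ.pos-* a a) ⟩
    ℤ.- Nα a b d ℤ.+ + a ℤ.* + a  ≡⟨ solve 3 (λ A B D → :- (A :* A :- B :* D) :+ A :* A := B :* D)
                                         refl (+ a) (+ (b ^ 4)) (+ d) ⟩
    + (b ^ 4) ℤ.* + d             ≡⟨ ℤ.pos-* (b ^ 4) d ⟨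
    + (b ^ 4 * d)                 ∎)
    where open ≡-Reasoning

  forward-index : ∀ {k} → + 3 ℤ.≤ k → ∃[ i ] k ≡ + (3 + i)
  forward-index {+ m} (ℤ.+≤+ 3≤m) = m ∸ 3 , cong +_ (sym (m+[n∸m]≡n 3≤m))

  backward-index : ∀ {K k} → k ℤ.≤ K ℤ.- + 2 → ∃[ i ] k ≡ ℤ.suc K ℤ.- + (3 + i)
  backward-index {K} {k} k≤K-2 = ∣ r ∣ , (begin
    k
      ≡⟨ solve 2 (λ K k → k := (con (+ 1) :+ K) :- (con (+ 3) :+ ((K :- con (+ 2)) :- k))) refl K k ⟩
    ℤ.suc K ℤ.- (+ 3 ℤ.+ r)
      ≡⟨ cong (λ e → ℤ.suc K ℤ.- (+ 3 ℤ.+ e)) (ℤ.0≤i⇒+∣i∣≡i (ℤ.i≤j⇒0≤j-i k≤K-2)) ⟨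
    ℤ.suc K ℤ.- (+ 3 ℤ.+ + ∣ r ∣)
      ≡⟨ cong (λ e → ℤ.suc K ℤ.- e) (ℤ.pos-+ 3 ∣ r ∣) ⟨
    ℤ.suc K ℤ.- + (3 + ∣ r ∣) ∎)
    where
    open ≡-Reasoning
    r = K ℤ.- + 2 ℤ.- k

module RationalLemmas where

  open import Agda.Builtin.FromNat using (fromNat)
  open import Data.Unit using (tt)
  import Data.Nat.Literals as ℕ
  import Data.Rational.Literals as ℚ
  open import Data.Nat as ℕ using (ℕ; zero; suc)
  open import Data.Nat.Properties using (n<1+n)
  open import Data.Integer as ℤ using (ℤ; +_; -[1+_]; 0ℤ)
  import Data.Integer.Properties as ℤ
  open import Data.Nat.Coprimality as Coprime using (1-coprimeTo)
  open import Data.Rational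
  open import Data.Rational.Properties
  open import Algebra.Definitions.RawSemiring +-*-rawSemiring using (_^_)
  open import Relation.Binary.PropositionalEquality
  open import Data.Sum using (_⊎_; inj₁; inj₂)
  open import Relation.Nullary using (¬_)
  open import Data.List using (List; []; _∷_)
  open import Data.Rational.Solver using (module +-*-Solver)
  open +-*-Solver using (solve; _:=_; _:+_; _:-_; :-_; _:*_; _:^_; con; Polynomial)
  open import Data.Product using (_×_; _,_; proj₁; proj₂)
  open import Defs using (ℕ→ℚ; QD; mulD; epsD; Nα; bound)
  open NatFacts using (trace-bounds; cube-condition)
  open IntFacts using (∣Nα∣+a²≡b⁴d; forward-index; backward-index)

  -- Numerals denote rationals in this module.  As a consequence the arity argument of the
  -- ring solver is an overloaded numeral as well, and its proof of the normalised identity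
  -- must be written as an implicit λ rather than a bare refl.
  instance
    ℕ-number = ℕ.number
    ℚ-number = ℚ.number

  ℕ→ℚ≡mkℚ : ∀ n → ℕ→ℚ n ≡ mkℚ (+ n) 0 (Coprime.sym (1-coprimeTo n))
  ℕ→ℚ≡mkℚ n = normalize-coprime (Coprime.sym (1-coprimeTo n))

  ℕ→ℚ-homo-+ : ∀ m n → ℕ→ℚ (m ℕ.+ n) ≡ ℕ→ℚ m + ℕ→ℚ n
  ℕ→ℚ-homo-+ m n = sym (trans (cong₂ _+_ (ℕ→ℚ≡mkℚ m) (ℕ→ℚ≡mkℚ n))
    (cong (_/ 1) (cong₂ ℤ._+_ (ℤ.*-identityʳ (+ m)) (ℤ.*-identityʳ (+ n)))))

  ℕ→ℚ-homo-* : ∀ m n → ℕ→ℚ (m ℕ.* n) ≡ ℕ→ℚ m * ℕ→ℚ n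
  ℕ→ℚ-homo-* m n = trans (cong (_/ 1) (ℤ.pos-* m n)) (sym (cong₂ _*_ (ℕ→ℚ≡mkℚ m) (ℕ→ℚ≡mkℚ n)))

  ℕ→ℚ-homo-^ : ∀ m n → ℕ→ℚ (m ℕ.^ n) ≡ ℕ→ℚ m ^ n
  ℕ→ℚ-homo-^ m zero = refl
  ℕ→ℚ-homo-^ m (suc n) = trans (ℕ→ℚ-homo-* m (m ℕ.^ n)) (cong (ℕ→ℚ m *_) (ℕ→ℚ-homo-^ m n))

  ℕ→ℚ-mono-≤ : ∀ {m n} → m ℕ.≤ n → ℕ→ℚ m ≤ ℕ→ℚ n
  ℕ→ℚ-mono-≤ {m} {n} m≤n = subst₂ _≤_ (sym (ℕ→ℚ≡mkℚ m)) (sym (ℕ→ℚ≡mkℚ n))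
    (*≤* (ℤ.*-monoʳ-≤-nonNeg (+ 1) (ℤ.+≤+ m≤n)))

  ℕ→ℚ-nonNeg : ∀ n → 0 ≤ ℕ→ℚ n
  ℕ→ℚ-nonNeg n = ℕ→ℚ-mono-≤ {0} {n} ℕ.z≤n

  ℕ→ℚ-pos : ∀ n .{{_ : ℕ.NonZero n}} → 0 < ℕ→ℚ n
  ℕ→ℚ-pos n = <-≤-trans (*<* (ℤ.+<+ ℕ.z<s)) (ℕ→ℚ-mono-≤ {1} {n} (ℕ.>-nonZero⁻¹ n))

  ℕ→ℚ-inverse : ∀ n .{{_ : ℕ.NonZero n}} → ℕ→ℚ n * (+ 1 / n) ≡ 1
  ℕ→ℚ-inverse n@(suc _) = trans (cong₂ _*_ (ℕ→ℚ≡mkℚ n) (normalize-coprime (1-coprimeTo n)))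
    (*-inverseʳ (mkℚ (+ n) 0 (Coprime.sym (1-coprimeTo n))))

  +/2≡ℕ→ℚ*½ : ∀ n → + n / 2 ≡ ℕ→ℚ n * ½
  +/2≡ℕ→ℚ*½ n = sym (trans (cong (_* ½) (ℕ→ℚ≡mkℚ n)) (cong (_/ 2) (ℤ.*-identityʳ (+ n))))

  ≤-by-gap : ∀ {p q} r → 0 ≤ r → q ≡ p + r → p ≤ q
  ≤-by-gap {p} r 0≤r refl = subst (_≤ p + r) (+-identityʳ p) (+-monoʳ-≤ p 0≤r)

  0≤+ : ∀ {p q} → 0 ≤ p → 0 ≤ q → 0 ≤ p + q
  0≤+ = +-mono-≤

  0≤* : ∀ {p q} → 0 ≤ p → 0 ≤ q → 0 ≤ p * q
  0≤* {p} {q} 0≤p 0≤q = nonNegative⁻¹ _ {{nonNeg*nonNeg⇒nonNeg p {{nonNegative 0≤p}} q {{nonNegative 0≤q}}}}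

  0≤^ : ∀ {p} n → 0 ≤ p → 0 ≤ p ^ n
  0≤^ zero 0≤p = *≤* (ℤ.+≤+ ℕ.z≤n)
  0≤^ (suc n) 0≤p = 0≤* 0≤p (0≤^ n 0≤p)

  0<* : ∀ {p q} → 0 < p → 0 < q → 0 < p * q
  0<* {p} {q} 0<p 0<q = positive⁻¹ _ {{pos*pos⇒pos p {{positive 0<p}} q {{positive 0<q}}}}

  0<^ : ∀ {p} n → 0 < p → 0 < p ^ n
  0<^ zero 0<p = ℕ→ℚ-pos 1
  0<^ (suc n) 0<p = 0<* 0<p (0<^ n 0<p)

  0≤² : ∀ p → 0 ≤ p ^ 2
  0≤² p = subst (0 ≤_) (cong (p *_) (sym (*-identityʳ p))) (0≤p*p (≤-total 0 p))
    where
    0≤p*p : 0 ≤ p ⊎ p ≤ 0 → 0 ≤ p * p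
    0≤p*p (inj₁ 0≤p) = 0≤* 0≤p 0≤p
    0≤p*p (inj₂ p≤0) = nonNegative⁻¹ _ {{nonPos*nonPos⇒nonPos p {{nonPositive p≤0}} p {{nonPositive p≤0}}}}

  p≤q⇒0≤q-p : ∀ {p q} → p ≤ q → 0 ≤ q - p
  p≤q⇒0≤q-p {p} {q} p≤q = subst (_≤ q - p) (+-inverseʳ p) (+-monoˡ-≤ (- p) p≤q)

  ^-mono-≤ : ∀ {p q} n → 0 ≤ p → p ≤ q → p ^ n ≤ q ^ n
  ^-mono-≤ zero 0≤p p≤q = ≤-refl
  ^-mono-≤ {p} {q} (suc n) 0≤p p≤q = ≤-trans
    (*-monoʳ-≤-nonNeg (p ^ n) {{nonNegative (0≤^ n 0≤p)}} p≤q)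
    (*-monoˡ-≤-nonNeg q {{nonNegative (≤-trans 0≤p p≤q)}} (^-mono-≤ n 0≤p p≤q))

  *-monoˡ-≤-0≤ : ∀ {p q} r → 0 ≤ r → p ≤ q → r * p ≤ r * q
  *-monoˡ-≤-0≤ r 0≤r = *-monoˡ-≤-nonNeg r {{nonNegative 0≤r}}

  0≤r*p⇒0≤p : ∀ {r p} → 0 < r → 0 ≤ r * p → 0 ≤ p
  0≤r*p⇒0≤p {r} {p} 0<r 0≤r*p = *-cancelˡ-≤-pos r {{positive 0<r}} (subst (_≤ r * p) (sym (*-zeroʳ r)) 0≤r*p)

  -- Polynomial inequalities

  horner : List ℕ → ℚ → ℚ
  horner [] x = 0
  horner (c ∷ cs) x = ℕ→ℚ c + x * horner cs x

  horner-poly : ∀ {n} → List ℕ → Polynomial n → Polynomial n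
  horner-poly [] x = con 0
  horner-poly (c ∷ cs) x = con (ℕ→ℚ c) :+ x :* horner-poly cs x

  horner-nonNeg : ∀ cs {x} → 0 ≤ x → 0 ≤ horner cs x
  horner-nonNeg [] 0≤x = ≤-refl
  horner-nonNeg (c ∷ cs) 0≤x = 0≤+ (ℕ→ℚ-nonNeg c) (0≤* 0≤x (horner-nonNeg cs 0≤x))

  -- 6912/823543 = 3³4⁴/7⁷ is the maximum of x³z⁴ on x + z = 1, attained where 4x = 3z.
  amgm-3-4 : ∀ {x z} → 0 ≤ x → 0 ≤ z → 823543 * (x ^ 3 * z ^ 4) ≤ 6912 * (x + z) ^ 7
  amgm-3-4 {x} {z} 0≤x 0≤z = ≤-by-gap ((4 * x - 3 * z) ^ 2 * cofactor) (0≤* (0≤² (4 * x - 3 * z)) 0≤cofactor)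
    (solve 2 (λ x z → con 6912 :* (x :+ z) :^ 7 := con 823543 :* (x :^ 3 :* z :^ 4) :+ (con 4 :* x :- con 3 :* z) :^ 2
       :* (con 768 :* z :^ 5 :+ x :* (con 7424 :* z :^ 4 :+ x :* (con 34560 :* z :^ 3
           :+ x :* (con 14337 :* z :^ 2 :+ x :* (con 3672 :* z :+ x :* con 432))))))
      (λ {_ _} → refl) x z)
    where
    cofactor = 768 * z ^ 5 + x * (7424 * z ^ 4 + x * (34560 * z ^ 3 + x * (14337 * z ^ 2 + x * (3672 * z + x * 432))))
    0≤cofactor : 0 ≤ cofactor
    0≤cofactor = 0≤+ (0≤* (ℕ→ℚ-nonNeg 768) (0≤^ 5 0≤z)) (0≤* 0≤x (0≤+ (0≤* (ℕ→ℚ-nonNeg 7424) (0≤^ 4 0≤z))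
      (0≤* 0≤x (0≤+ (0≤* (ℕ→ℚ-nonNeg 34560) (0≤^ 3 0≤z)) (0≤* 0≤x (0≤+ (0≤* (ℕ→ℚ-nonNeg 14337) (0≤^ 2 0≤z))
      (0≤* 0≤x (0≤+ (0≤* (ℕ→ℚ-nonNeg 3672) 0≤z) (0≤* 0≤x (ℕ→ℚ-nonNeg 432))))))))))

  -- The difference, expanded around T = 218, has nonnegative coefficients.
  trace-polynomial-bound : ∀ {T} → 218 ≤ T →
    11324620800 * (T ^ 7 * (T + 2) ^ 3) ≤ 11698428315 * ((T ^ 2 - T - 1) * (T ^ 2 - 4) ^ 4)
  trace-polynomial-bound {T} 218≤T = ≤-by-gap (horner gap (T - 218)) (horner-nonNeg gap (p≤q⇒0≤q-p 218≤T))
    (solve 1 (λ T → con 11698428315 :* ((T :^ 2 :- T :- con 1) :* (T :^ 2 :- con 4) :^ 4)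
       := con 11324620800 :* (T :^ 7 :* (T :+ con 2) :^ 3) :+ horner-poly gap (T :- con 218)) (λ {_} → refl) T)
    where
    gap : List ℕ
    gap = 345175408420476482351923200000 ∷ 437738379172591391270830080000 ∷ 17709152893358418769711104000
      ∷ 322282907319565077584486400 ∷ 3431781934270568090284800 ∷ 23520613294749926208000
      ∷ 107535558335168641440 ∷ 327880433257377360 ∷ 642816754286115 ∷ 735254229585 ∷ 373807515 ∷ []

  -- The estimate for one pair Y ≤ B ≤ X

  Φ : ℚ → ℚ → ℚ → ℚ
  Φ T X Y = T * X * Y - X ^ 2 - Y ^ 2

  Φ-sym : ∀ T X Y → Φ T X Y ≡ Φ T Y X
  Φ-sym = solve 3 (λ T X Y → T :* X :* Y :- X :^ 2 :- Y :^ 2 := T :* Y :* X :- Y :^ 2 :- X :^ 2) (λ {_ _ _} → refl)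

  Φ≤X[TB-X] : ∀ {T B X Y} → 0 ≤ T → 0 ≤ X → Y ≤ B → Φ T X Y ≤ X * (T * B - X)
  Φ≤X[TB-X] {T} {B} {X} {Y} 0≤T 0≤X Y≤B = ≤-by-gap (T * X * (B - Y) + Y ^ 2)
    (0≤+ (0≤* (0≤* 0≤T 0≤X) (p≤q⇒0≤q-p Y≤B)) (0≤² Y))
    (solve 4 (λ T B X Y → X :* (T :* B :- X) := (T :* X :* Y :- X :^ 2 :- Y :^ 2) :+ (T :* X :* (B :- Y) :+ Y :^ 2))
      (λ {_ _ _ _} → refl) T B X Y)

  Φ⁴-bound : ∀ {T B X Y} → 0 ≤ T → 0 < X → Y ≤ B → 0 ≤ Φ T X Y → 823543 * Φ T X Y ^ 4 ≤ 6912 * X * (T * B) ^ 7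
  Φ⁴-bound {T} {B} {X} {Y} 0≤T 0<X Y≤B 0≤Φ = begin
    823543 * Φ T X Y ^ 4             ≤⟨ *-monoˡ-≤-0≤ 823543 (ℕ→ℚ-nonNeg 823543) (^-mono-≤ 4 0≤Φ Φ≤XZ) ⟩
    823543 * (X * Z) ^ 4             ≡⟨ solve 2 (λ X Z → con 823543 :* (X :* Z) :^ 4 := X :* (con 823543 :* (X :^ 3 :* Z :^ 4)))
                                          (λ {_ _} → refl) X Z ⟩
    X * (823543 * (X ^ 3 * Z ^ 4))   ≤⟨ *-monoˡ-≤-0≤ X 0≤X (amgm-3-4 0≤X 0≤Z) ⟩
    X * (6912 * (X + Z) ^ 7)         ≡⟨ solve 3 (λ T B X → X :* (con 6912 :* (X :+ (T :* B :- X)) :^ 7) := con 6912 :* X :* (T :* B) :^ 7)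
                                          (λ {_ _ _} → refl) T B X ⟩
    6912 * X * (T * B) ^ 7           ∎
    where
    open ≤-Reasoning
    Z = T * B - X
    0≤X = <⇒≤ 0<X
    Φ≤XZ = Φ≤X[TB-X] 0≤T 0≤X Y≤B
    0≤Z : 0 ≤ Z
    0≤Z = 0≤r*p⇒0≤p 0<X (≤-trans 0≤Φ Φ≤XZ)

  218≤T⇒2≤T : ∀ {T} → 218 ≤ T → 2 ≤ T
  218≤T⇒2≤T = ≤-trans (ℕ→ℚ-mono-≤ {2} {218} (ℕ.s≤s (ℕ.s≤s ℕ.z≤n)))

  218≤T⇒0<T²-4 : ∀ {T} → 218 ≤ T → 0 < T ^ 2 - 4
  218≤T⇒0<T²-4 {T} 218≤T = <-≤-trans (ℕ→ℚ-pos 47520) (≤-by-gap ((T - 218) * (436 + (T - 218)))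
    (0≤* (p≤q⇒0≤q-p 218≤T) (0≤+ (ℕ→ℚ-nonNeg 436) (p≤q⇒0≤q-p 218≤T)))
    (solve 1 (λ T → T :^ 2 :- con 4 := con 47520 :+ (T :- con 218) :* (con 436 :+ (T :- con 218))) (λ {_} → refl) T))

  -- 11698428315 = 15 · 7⁷ · 947 clears the denominators of the three inequalities used.
  pair-bound : ∀ {T B D n X Y} → 218 ≤ T → 0 < B → 0 < D → 0 ≤ n → Y ≤ B → B ≤ X
    → 947 * B ^ 9 * D ^ 2 ≤ 100 * (T + 2) ^ 3
    → (T ^ 2 - 4) * n ≡ 4 * D * Φ T X Y
    → 64 * (B ^ 2 * n ^ 4) ≤ 15 * (D ^ 2 * ((T ^ 2 - 1) * X - T * Y))
  pair-bound {T} {B} {D} {n} {X} {Y} 218≤T 0<B 0<D 0≤n Y≤B B≤X small-B disc =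
    *-cancelˡ-≤-pos (11698428315 * M ^ 4) {{positive 0<c₀M⁴}} (begin
      11698428315 * M ^ 4 * (64 * (B ^ 2 * n ^ 4))
        ≡⟨ solve 3 (λ M B n → con 11698428315 :* M :^ 4 :* (con 64 :* (B :^ 2 :* n :^ 4))
                              := con 11698428315 :* con 64 :* B :^ 2 :* (M :* n) :^ 4) (λ {_ _ _} → refl) M B n ⟩
      11698428315 * 64 * B ^ 2 * (M * n) ^ 4
        ≡⟨ cong (λ e → 11698428315 * 64 * B ^ 2 * e ^ 4) disc ⟩
      11698428315 * 64 * B ^ 2 * (4 * D * Φ T X Y) ^ 4
        ≡⟨ solve 3 (λ B D F → con 11698428315 :* con 64 :* B :^ 2 :* (con 4 :* D :* F) :^ 4
                              := con 232734720 :* (B :^ 2 :* D :^ 4) :* (con 823543 :* F :^ 4)) (λ {_ _ _} → refl) B D (Φ T X Y) ⟩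
      232734720 * (B ^ 2 * D ^ 4) * (823543 * Φ T X Y ^ 4)
        ≤⟨ *-monoˡ-≤-0≤ _ (0≤* (ℕ→ℚ-nonNeg 232734720) (0≤* (0≤^ 2 0≤B) (0≤^ 4 0≤D)))
             (Φ⁴-bound 0≤T 0<X Y≤B 0≤Φ) ⟩
      232734720 * (B ^ 2 * D ^ 4) * (6912 * X * (T * B) ^ 7)
        ≡⟨ solve 4 (λ T B D X → con 232734720 :* (B :^ 2 :* D :^ 4) :* (con 6912 :* X :* (T :* B) :^ 7)
                                := con 1698693120 :* (X :* T :^ 7 :* D :^ 2) :* (con 947 :* B :^ 9 :* D :^ 2))
                   (λ {_ _ _ _} → refl) T B D X ⟩
      1698693120 * (X * T ^ 7 * D ^ 2) * (947 * B ^ 9 * D ^ 2)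
        ≤⟨ *-monoˡ-≤-0≤ _ (0≤* (ℕ→ℚ-nonNeg 1698693120) (0≤* (0≤* 0≤X (0≤^ 7 0≤T)) (0≤^ 2 0≤D))) small-B ⟩
      1698693120 * (X * T ^ 7 * D ^ 2) * (100 * (T + 2) ^ 3)
        ≡⟨ solve 3 (λ T D X → con 1698693120 :* (X :* T :^ 7 :* D :^ 2) :* (con 100 :* (T :+ con 2) :^ 3)
                              := con 15 :* X :* D :^ 2 :* (con 11324620800 :* (T :^ 7 :* (T :+ con 2) :^ 3))) (λ {_ _ _} → refl) T D X ⟩
      15 * X * D ^ 2 * (11324620800 * (T ^ 7 * (T + 2) ^ 3))
        ≤⟨ *-monoˡ-≤-0≤ _ (0≤* (0≤* (ℕ→ℚ-nonNeg 15) 0≤X) (0≤^ 2 0≤D)) (trace-polynomial-bound 218≤T) ⟩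
      15 * X * D ^ 2 * (11698428315 * ((T ^ 2 - T - 1) * M ^ 4))
        ≤⟨ ≤-by-gap (11698428315 * M ^ 4 * (15 * D ^ 2 * (T * (X - Y))))
             (0≤* (<⇒≤ 0<c₀M⁴) (0≤* (0≤* (ℕ→ℚ-nonNeg 15) (0≤^ 2 0≤D))
               (0≤* 0≤T (p≤q⇒0≤q-p (≤-trans Y≤B B≤X)))))
             (solve 5 (λ T D X Y M → con 11698428315 :* M :^ 4 :* (con 15 :* (D :^ 2 :* ((T :^ 2 :- con 1) :* X :- T :* Y)))
                := con 15 :* X :* D :^ 2 :* (con 11698428315 :* ((T :^ 2 :- T :- con 1) :* M :^ 4))
                   :+ con 11698428315 :* M :^ 4 :* (con 15 :* D :^ 2 :* (T :* (X :- Y)))) (λ {_ _ _ _ _} → refl) T D X Y M) ⟩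
      11698428315 * M ^ 4 * (15 * (D ^ 2 * ((T ^ 2 - 1) * X - T * Y))) ∎)
    where
    open ≤-Reasoning
    M = T ^ 2 - 4
    0≤T = ≤-trans (ℕ→ℚ-nonNeg 218) 218≤T
    0≤B = <⇒≤ 0<B
    0≤D = <⇒≤ 0<D
    0<X = <-≤-trans 0<B B≤X
    0≤X = <⇒≤ 0<X
    0<M = 218≤T⇒0<T²-4 218≤T
    0<c₀M⁴ : 0 < 11698428315 * M ^ 4
    0<c₀M⁴ = 0<* (ℕ→ℚ-pos 11698428315) (0<^ 4 0<M)
    0≤Φ : 0 ≤ Φ T X Y
    0≤Φ = 0≤r*p⇒0≤p (0<* (ℕ→ℚ-pos 4) 0<D) (subst (0 ≤_) disc (0≤* (<⇒≤ 0<M) 0≤n))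

  -- Three-term recurrences

  Recurrent : ℚ → (ℕ → ℚ) → Set
  Recurrent T s = ∀ i → s (2 ℕ.+ i) ≡ T * s (1 ℕ.+ i) - s i

  recurrent-increasing : ∀ {T s} → 2 ≤ T → Recurrent T s → 0 ≤ s 1 → s 0 ≤ s 1
    → ∀ i → 0 ≤ s (1 ℕ.+ i) × s i ≤ s (1 ℕ.+ i)
  recurrent-increasing 2≤T rec 0≤s₁ s₀≤s₁ zero = 0≤s₁ , s₀≤s₁
  recurrent-increasing {T} {s} 2≤T rec 0≤s₁ s₀≤s₁ (suc i) with recurrent-increasing 2≤T rec 0≤s₁ s₀≤s₁ i
  ... | 0≤sᵢ₊₁ , sᵢ≤sᵢ₊₁ = ≤-trans 0≤sᵢ₊₁ sᵢ₊₁≤sᵢ₊₂ , sᵢ₊₁≤sᵢ₊₂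
    where
    sᵢ₊₁≤sᵢ₊₂ : s (1 ℕ.+ i) ≤ s (2 ℕ.+ i)
    sᵢ₊₁≤sᵢ₊₂ = ≤-by-gap ((T - 2) * s (1 ℕ.+ i) + (s (1 ℕ.+ i) - s i))
      (0≤+ (0≤* (p≤q⇒0≤q-p 2≤T) 0≤sᵢ₊₁) (p≤q⇒0≤q-p sᵢ≤sᵢ₊₁))
      (trans (rec i) (solve 3 (λ T a b → T :* b :- a := b :+ ((T :- con 2) :* b :+ (b :- a)))
                       (λ {_ _ _} → refl) T (s i) (s (1 ℕ.+ i))))

  recurrent-third : ∀ {T s} → Recurrent T s → s 3 ≡ (T ^ 2 - 1) * s 1 - T * s 0
  recurrent-third {T} {s} rec = begin
    s 3                          ≡⟨ rec 1 ⟩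
    T * s 2 - s 1                ≡⟨ cong (λ e → T * e - s 1) (rec 0) ⟩
    T * (T * s 1 - s 0) - s 1    ≡⟨ solve 3 (λ T a b → T :* (T :* b :- a) :- b := (T :^ 2 :- con 1) :* b :- T :* a)
                                      (λ {_ _ _} → refl) T (s 0) (s 1) ⟩
    (T ^ 2 - 1) * s 1 - T * s 0  ∎
    where open ≡-Reasoning

  recurrent-lower-bound : ∀ {T s} → 2 ≤ T → Recurrent T s → 0 ≤ s 1 → s 0 ≤ s 1
    → ∀ i → (T ^ 2 - 1) * s 1 - T * s 0 ≤ s (3 ℕ.+ i)
  recurrent-lower-bound {T} {s} 2≤T rec 0≤s₁ s₀≤s₁ zero = ≤-reflexive (sym (recurrent-third {T} {s} rec))
  recurrent-lower-bound 2≤T rec 0≤s₁ s₀≤s₁ (suc i) =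
    ≤-trans (recurrent-lower-bound 2≤T rec 0≤s₁ s₀≤s₁ i)
      (proj₂ (recurrent-increasing 2≤T rec 0≤s₁ s₀≤s₁ (3 ℕ.+ i)))

  tail-bound : ∀ {T B D n s} → 218 ≤ T → 0 < B → 0 < D → 0 ≤ n → 947 * B ^ 9 * D ^ 2 ≤ 100 * (T + 2) ^ 3
    → Recurrent T s → s 0 ≤ B → B ≤ s 1 → (T ^ 2 - 4) * n ≡ 4 * D * Φ T (s 1) (s 0)
    → ∀ i → 64 * (B ^ 2 * n ^ 4) ≤ 15 * (D ^ 2 * s (3 ℕ.+ i))
  tail-bound {T} {B} {D} {n} {s} 218≤T 0<B 0<D 0≤n small-B rec s₀≤B B≤s₁ disc i =
    ≤-trans (pair-bound 218≤T 0<B 0<D 0≤n s₀≤B B≤s₁ small-B disc)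
      (*-monoˡ-≤-0≤ 15 (ℕ→ℚ-nonNeg 15) (*-monoˡ-≤-0≤ (D ^ 2) (0≤^ 2 (<⇒≤ 0<D))
        (recurrent-lower-bound 2≤T rec (≤-trans (<⇒≤ 0<B) B≤s₁) (≤-trans s₀≤B B≤s₁) i)))
    where 2≤T = 218≤T⇒2≤T 218≤T

  Recurrentℤ : ℚ → (ℤ → ℚ) → Set
  Recurrentℤ T y = ∀ k → y (ℤ.suc (ℤ.suc k)) ≡ T * y (ℤ.suc k) - y k

  recurrent-forward : ∀ {T y} → Recurrentℤ T y → Recurrent T (λ i → y (+ i))
  recurrent-forward rec i = rec (+ i)

  recurrent-backward : ∀ {T y} → Recurrentℤ T y → ∀ c → Recurrent T (λ i → y (c ℤ.- + i))
  recurrent-backward {T} {y} rec c i = begin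
    y k                                        ≡⟨ solve 3 (λ T a b → a := T :* b :- (T :* b :- a)) (λ {_ _ _} → refl)
                                                    T (y k) (y (ℤ.suc k)) ⟩
    T * y (ℤ.suc k) - (T * y (ℤ.suc k) - y k)  ≡⟨ cong (λ e → T * y (ℤ.suc k) - e) (sym (rec k)) ⟩
    T * y (ℤ.suc k) - y (ℤ.suc (ℤ.suc k))      ≡⟨ cong₂ (λ j l → T * y j - y l) (suc[c-[1+j]]≡c-j c (suc i))
                                                    (trans (cong ℤ.suc (suc[c-[1+j]]≡c-j c (suc i))) (suc[c-[1+j]]≡c-j c i)) ⟩
    T * y (c ℤ.- + suc i) - y (c ℤ.- + i)      ∎
    where
    open ≡-Reasoning
    k = c ℤ.- + suc (suc i)
    suc[c-[1+j]]≡c-j : ∀ c j → ℤ.suc (c ℤ.- + suc j) ≡ c ℤ.- + j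
    suc[c-[1+j]]≡c-j c j = trans (cong ℤ.suc (ℤ.minus-suc c j)) (ℤ.suc-pred (c ℤ.- + j))

  -- Orbits under multiplication by an element of norm 1

  sucℤ-invariant⇒constant : ∀ {A : Set} (f : ℤ → A) → (∀ k → f (ℤ.suc k) ≡ f k) → ∀ k → f k ≡ f 0ℤ
  sucℤ-invariant⇒constant f inv (+ zero) = refl
  sucℤ-invariant⇒constant f inv (+ suc n) = trans (inv (+ n)) (sucℤ-invariant⇒constant f inv (+ n))
  sucℤ-invariant⇒constant f inv -[1+ zero ] = sym (inv -[1+ zero ])
  sucℤ-invariant⇒constant f inv -[1+ suc n ] = trans (sym (inv -[1+ suc n ])) (sucℤ-invariant⇒constant f inv -[1+ n ])

  norm : ℕ → QD → ℚ
  norm d (x , y) = x ^ 2 - ℕ→ℚ d * y ^ 2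

  norm-mulD : ∀ d v w → norm d (mulD d v w) ≡ norm d v * norm d w
  norm-mulD d (x , y) (p , q) = solve 5 (λ D x y p q → (x :* p :+ D :* (y :* q)) :^ 2 :- D :* (x :* q :+ y :* p) :^ 2
    := (x :^ 2 :- D :* y :^ 2) :* (p :^ 2 :- D :* q :^ 2)) (λ {_ _ _ _ _} → refl) (ℕ→ℚ d) x y p q

  mulD-assoc : ∀ d u v w → mulD d (mulD d u v) w ≡ mulD d u (mulD d v w)
  mulD-assoc d (x , y) (p , q) (r , s) = cong₂ _,_
    (solve 7 (λ D x y p q r s → (x :* p :+ D :* (y :* q)) :* r :+ D :* ((x :* q :+ y :* p) :* s)
      := x :* (p :* r :+ D :* (q :* s)) :+ D :* (y :* (p :* s :+ q :* r))) (λ {_ _ _ _ _ _ _} → refl) (ℕ→ℚ d) x y p q r s)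
    (solve 7 (λ D x y p q r s → (x :* p :+ D :* (y :* q)) :* s :+ (x :* q :+ y :* p) :* r
      := x :* (p :* s :+ q :* r) :+ y :* (p :* r :+ D :* (q :* s))) (λ {_ _ _ _ _ _ _} → refl) (ℕ→ℚ d) x y p q r s)

  module Orbit (d : ℕ) (η : QD) (unit : norm d η ≡ 1) where

    D = ℕ→ℚ d
    p = proj₁ η
    q = proj₂ η
    T = 2 * p

    modulo-unit : ∀ {l r} c → l ≡ r + c * (1 - norm d η) → l ≡ r
    modulo-unit {r = r} c l≡ = trans l≡ (trans (cong (λ ν → r + c * (1 - ν)) unit)
      (solve 2 (λ r c → r :+ c :* (con 1 :- con 1) := r) (λ {_ _} → refl) r c))

    norm-step : ∀ v → norm d (mulD d v η) ≡ norm d v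
    norm-step v = trans (norm-mulD d v η) (trans (cong (norm d v *_) unit) (*-identityʳ (norm d v)))

    y-recurrence-step : ∀ v → proj₂ (mulD d (mulD d v η) η) ≡ T * proj₂ (mulD d v η) - proj₂ v
    y-recurrence-step (x , y) = modulo-unit y
      (solve 5 (λ D x y p q → (x :* p :+ D :* (y :* q)) :* q :+ (x :* q :+ y :* p) :* p
        := con 2 :* p :* (x :* q :+ y :* p) :- y :+ y :* (con 1 :- (p :^ 2 :- D :* q :^ 2))) (λ {_ _ _ _ _} → refl) D x y p q)

    discriminant-step : ∀ v → (T ^ 2 - 4) * - norm d v ≡ 4 * D * Φ T (proj₂ v) (proj₂ (mulD d v η))
    discriminant-step (x , y) = modulo-unit (4 * x ^ 2)
      (solve 5 (λ D x y p q → ((con 2 :* p) :^ 2 :- con 4) :* (:- (x :^ 2 :- D :* y :^ 2))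
        := con 4 :* D :* (con 2 :* p :* y :* (x :* q :+ y :* p) :- y :^ 2 :- (x :* q :+ y :* p) :^ 2)
           :+ con 4 :* x :^ 2 :* (con 1 :- (p :^ 2 :- D :* q :^ 2))) (λ {_ _ _ _ _} → refl) D x y p q)

    module Sequence (x y : ℤ → ℚ) (step : ∀ k → (x (ℤ.suc k) , y (ℤ.suc k)) ≡ mulD d (x k , y k) η) where

      y-recurrence : Recurrentℤ T y
      y-recurrence k = begin
        y (ℤ.suc (ℤ.suc k))                         ≡⟨ cong proj₂ (step (ℤ.suc k)) ⟩
        proj₂ (mulD d (x (ℤ.suc k) , y (ℤ.suc k)) η) ≡⟨ cong (λ v → proj₂ (mulD d v η)) (step k) ⟩
        proj₂ (mulD d (mulD d (x k , y k) η) η)     ≡⟨ y-recurrence-step (x k , y k) ⟩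
        T * proj₂ (mulD d (x k , y k) η) - y k      ≡⟨ cong (λ v → T * proj₂ v - y k) (step k) ⟨
        T * y (ℤ.suc k) - y k                       ∎
        where open ≡-Reasoning

      norm-invariant : ∀ k → norm d (x k , y k) ≡ norm d (x 0ℤ , y 0ℤ)
      norm-invariant = sucℤ-invariant⇒constant (λ k → norm d (x k , y k))
        (λ k → trans (cong (norm d) (step k)) (norm-step (x k , y k)))

      discriminant : ∀ k → (T ^ 2 - 4) * - norm d (x k , y k) ≡ 4 * D * Φ T (y k) (y (ℤ.suc k))
      discriminant k = trans (discriminant-step (x k , y k)) (cong (λ v → 4 * D * Φ T (y k) (proj₂ v)) (sym (step k)))

      discriminant-invariant : ∀ {n} → n ≡ - norm d (x 0ℤ , y 0ℤ) → ∀ k → (T ^ 2 - 4) * n ≡ 4 * D * Φ T (y k) (y (ℤ.suc k))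
      discriminant-invariant n≡ k = trans (cong ((T ^ 2 - 4) *_) (trans n≡ (cong -_ (sym (norm-invariant k))))) (discriminant k)

  -- u≢0 is not an instance argument: a local NonZero instance would be tried, and fail,
  -- for the literal denominators below.
  module UnitSquare (d t u : ℕ) .(u≢0 : ℕ.NonZero u)
                    (unit-eq : t ℕ.* t ≡ u ℕ.* u ℕ.* d ℕ.+ 4 ⊎ t ℕ.* t ℕ.+ 4 ≡ u ℕ.* u ℕ.* d) where

    ε = epsD t u
    η = mulD d ε ε
    T = 2 * proj₁ η
    D = ℕ→ℚ d
    t² = ℕ→ℚ (t ℕ.* t)
    u²d = ℕ→ℚ (u ℕ.* u ℕ.* d)

    coordinates : ε ≡ (ℕ→ℚ t * ½ , ℕ→ℚ u * ½)
    coordinates = cong₂ _,_ (+/2≡ℕ→ℚ*½ t) (+/2≡ℕ→ℚ*½ u)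

    t²≡ : t² ≡ ℕ→ℚ t * ℕ→ℚ t
    t²≡ = ℕ→ℚ-homo-* t t

    u²d≡ : u²d ≡ ℕ→ℚ u * ℕ→ℚ u * D
    u²d≡ = trans (ℕ→ℚ-homo-* (u ℕ.* u) d) (cong (_* D) (ℕ→ℚ-homo-* u u))

    norm-ε : norm d ε ≡ (t² - u²d) * (+ 1 / 4)
    norm-ε = trans (cong (norm d) coordinates) (trans
      (solve 3 (λ t u D → (t :* con ½) :^ 2 :- D :* (u :* con ½) :^ 2 := (t :* t :- u :* u :* D) :* con (+ 1 / 4))
        (λ {_ _ _} → refl) (ℕ→ℚ t) (ℕ→ℚ u) D)
      (cong₂ (λ a b → (a - b) * (+ 1 / 4)) (sym t²≡) (sym u²d≡)))

    norm-η : norm d η ≡ 1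
    norm-η = trans (norm-mulD d ε ε) (trans (cong (λ e → e * e) norm-ε) (square≡1 unit-eq))
      where
      square≡1 : t ℕ.* t ≡ u ℕ.* u ℕ.* d ℕ.+ 4 ⊎ t ℕ.* t ℕ.+ 4 ≡ u ℕ.* u ℕ.* d
        → (t² - u²d) * (+ 1 / 4) * ((t² - u²d) * (+ 1 / 4)) ≡ 1
      square≡1 (inj₁ e) = trans (cong (λ a → (a - u²d) * (+ 1 / 4) * ((a - u²d) * (+ 1 / 4)))
                                  (trans (cong ℕ→ℚ e) (ℕ→ℚ-homo-+ (u ℕ.* u ℕ.* d) 4)))
        (solve 1 (λ w → (w :+ con 4 :- w) :* con (+ 1 / 4) :* ((w :+ con 4 :- w) :* con (+ 1 / 4)) := con 1) (λ {_} → refl) u²d)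
      square≡1 (inj₂ e) = trans (cong (λ b → (t² - b) * (+ 1 / 4) * ((t² - b) * (+ 1 / 4)))
                                  (trans (cong ℕ→ℚ (sym e)) (ℕ→ℚ-homo-+ (t ℕ.* t) 4)))
        (solve 1 (λ s → (s :- (s :+ con 4)) :* con (+ 1 / 4) :* ((s :- (s :+ con 4)) :* con (+ 1 / 4)) := con 1) (λ {_} → refl) t²)

    T≡ : T ≡ (t² + u²d) * ½
    T≡ = trans (cong (λ v → 2 * proj₁ (mulD d v v)) coordinates) (trans
      (solve 3 (λ t u D → con 2 :* (t :* con ½ :* (t :* con ½) :+ D :* (u :* con ½ :* (u :* con ½))) := (t :* t :+ u :* u :* D) :* con ½)
        (λ {_ _ _} → refl) (ℕ→ℚ t) (ℕ→ℚ u) D)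
      (cong₂ (λ a b → (a + b) * ½) (sym t²≡) (sym u²d≡)))

    0≤proj₂η : 0 ≤ proj₂ η
    0≤proj₂η = subst (λ v → 0 ≤ proj₂ (mulD d v v)) (sym coordinates)
      (0≤+ (0≤* t/2 u/2) (0≤* u/2 t/2))
      where
      t/2 = 0≤* (ℕ→ℚ-nonNeg t) (nonNegative⁻¹ ½)
      u/2 = 0≤* (ℕ→ℚ-nonNeg u) (nonNegative⁻¹ ½)

    module _ (201<d : 201 ℕ.< d) where

      t²+u²d-bounds = trace-bounds d t u {{u≢0}} 201<d unit-eq

      218≤T : 218 ≤ T
      218≤T = subst (218 ≤_) (sym T≡) (*-monoʳ-≤-nonNeg ½
        (subst (436 ≤_) (ℕ→ℚ-homo-+ (t ℕ.* t) (u ℕ.* u ℕ.* d)) (ℕ→ℚ-mono-≤ (proj₁ t²+u²d-bounds))))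

      u²d≤T+2 : u²d ≤ T + 2
      u²d≤T+2 = ≤-by-gap ((t² + 4 - u²d) * ½) (0≤* (p≤q⇒0≤q-p u²d≤t²+4) (nonNegative⁻¹ ½))
        (trans (cong (_+ 2) T≡)
          (solve 2 (λ s w → (s :+ w) :* con ½ :+ con 2 := w :+ (s :+ con 4 :- w) :* con ½) (λ {_ _} → refl) t² u²d))
        where
        u²d≤t²+4 : u²d ≤ t² + 4
        u²d≤t²+4 = subst (u²d ≤_) (ℕ→ℚ-homo-+ (t ℕ.* t) 4) (ℕ→ℚ-mono-≤ (proj₂ t²+u²d-bounds))

      y-grows : ∀ {x y} → 0 ≤ x → 0 ≤ y → y ≤ proj₂ (mulD d (x , y) η)
      y-grows {x} {y} 0≤x 0≤y = ≤-by-gap (x * proj₂ η + y * ((T - 2) * ½))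
        (0≤+ (0≤* 0≤x 0≤proj₂η) (0≤* 0≤y (0≤* (p≤q⇒0≤q-p (218≤T⇒2≤T 218≤T)) (nonNegative⁻¹ ½))))
        (solve 4 (λ x y p q → x :* q :+ y :* p := y :+ (x :* q :+ y :* ((con 2 :* p :- con 2) :* con ½)))
          (λ {_ _ _ _} → refl) x y (proj₁ η) (proj₂ η))

  cube-condition-ℚ : ∀ b d u {S} → 947 ℕ.* b ℕ.^ 18 ℕ.< 100 ℕ.* d ℕ.* u ℕ.^ 6 → ℕ→ℚ (u ℕ.* u ℕ.* d) ≤ S
    → 947 * ℕ→ℚ (b ℕ.^ 2) ^ 9 * ℕ→ℚ d ^ 2 ≤ 100 * S ^ 3
  cube-condition-ℚ b d u small-b u²d≤S = ≤-trans
    (subst₂ _≤_ lhs≡ rhs≡ (ℕ→ℚ-mono-≤ (cube-condition b d u small-b)))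
    (*-monoˡ-≤-0≤ 100 (ℕ→ℚ-nonNeg 100) (^-mono-≤ 3 (ℕ→ℚ-nonNeg (u ℕ.* u ℕ.* d)) u²d≤S))
    where
    lhs≡ : ℕ→ℚ (947 ℕ.* (b ℕ.^ 2) ℕ.^ 9 ℕ.* d ℕ.^ 2) ≡ 947 * ℕ→ℚ (b ℕ.^ 2) ^ 9 * ℕ→ℚ d ^ 2
    lhs≡ = trans (ℕ→ℚ-homo-* (947 ℕ.* (b ℕ.^ 2) ℕ.^ 9) (d ℕ.^ 2)) (cong₂ _*_
      (trans (ℕ→ℚ-homo-* 947 ((b ℕ.^ 2) ℕ.^ 9)) (cong (947 *_) (ℕ→ℚ-homo-^ (b ℕ.^ 2) 9))) (ℕ→ℚ-homo-^ d 2))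
    rhs≡ : ℕ→ℚ (100 ℕ.* (u ℕ.* u ℕ.* d) ℕ.^ 3) ≡ 100 * ℕ→ℚ (u ℕ.* u ℕ.* d) ^ 3
    rhs≡ = trans (ℕ→ℚ-homo-* 100 ((u ℕ.* u ℕ.* d) ℕ.^ 3)) (cong (100 *_) (ℕ→ℚ-homo-^ (u ℕ.* u ℕ.* d) 3))

  ∣Nα∣≡-norm : ∀ a b d → Nα a b d ℤ.< + 0 → ℕ→ℚ ℤ.∣ Nα a b d ∣ ≡ - norm d (ℕ→ℚ a , ℕ→ℚ (b ℕ.^ 2))
  ∣Nα∣≡-norm a b d Nα<0 = begin
    n                                     ≡⟨ solve 2 (λ n A → n := n :+ A :* A :- A :* A) (λ {_ _} → refl) n A ⟩
    n + A * A - A * A                     ≡⟨ cong (_- A * A) n+a²≡b⁴d ⟩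
    ℕ→ℚ b ^ 4 * D - A * A                 ≡⟨ solve 3 (λ b D A → b :^ 4 :* D :- A :* A := :- (A :^ 2 :- D :* (b :^ 2) :^ 2))
                                               (λ {_ _ _} → refl) (ℕ→ℚ b) D A ⟩
    - (A ^ 2 - D * (ℕ→ℚ b ^ 2) ^ 2)       ≡⟨ cong (λ B → - (A ^ 2 - D * B ^ 2)) (ℕ→ℚ-homo-^ b 2) ⟨
    - norm d (A , ℕ→ℚ (b ℕ.^ 2))          ∎
    where
    open ≡-Reasoning
    n = ℕ→ℚ ℤ.∣ Nα a b d ∣
    A = ℕ→ℚ a
    D = ℕ→ℚ d
    n+a²≡b⁴d : n + A * A ≡ ℕ→ℚ b ^ 4 * D
    n+a²≡b⁴d = trans (sym (trans (ℕ→ℚ-homo-+ ℤ.∣ Nα a b d ∣ (a ℕ.* a)) (cong (λ e → n + e) (ℕ→ℚ-homo-* a a))))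
      (trans (cong ℕ→ℚ (∣Nα∣+a²≡b⁴d a b d Nα<0)) (trans (ℕ→ℚ-homo-* (b ℕ.^ 4) d) (cong (_* D) (ℕ→ℚ-homo-^ b 4))))

  bound-≤ : ∀ a b d .(d≢0 : ℕ.NonZero d) {Y}
    → 64 * (ℕ→ℚ (b ℕ.^ 2) ^ 2 * ℕ→ℚ ℤ.∣ Nα a b d ∣ ^ 4) ≤ 15 * (ℕ→ℚ d ^ 2 * Y)
    → bound a b d {{d≢0}} ≤ Y
  bound-≤ a b d d≢0 {Y} h = begin
    bound a b d {{d≢0}}
      ≡⟨ cong (λ e → + 64 / 15 * e * (R * R)) b⁴n⁴≡ ⟩
    + 64 / 15 * (ℕ→ℚ b ^ 4 * n ^ 4) * (R * R)
      ≡⟨ solve 3 (λ b n R → con (+ 64 / 15) :* (b :^ 4 :* n :^ 4) :* (R :* R)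
                            := con (+ 1 / 15) :* R :^ 2 :* (con 64 :* ((b :^ 2) :^ 2 :* n :^ 4))) (λ {_ _ _} → refl) (ℕ→ℚ b) n R ⟩
    + 1 / 15 * R ^ 2 * (64 * ((ℕ→ℚ b ^ 2) ^ 2 * n ^ 4))
      ≡⟨ cong (λ B → + 1 / 15 * R ^ 2 * (64 * (B ^ 2 * n ^ 4))) (ℕ→ℚ-homo-^ b 2) ⟨
    + 1 / 15 * R ^ 2 * (64 * (ℕ→ℚ (b ℕ.^ 2) ^ 2 * n ^ 4))
      ≤⟨ *-monoˡ-≤-0≤ (+ 1 / 15 * R ^ 2) (0≤* (nonNegative⁻¹ (+ 1 / 15)) (0≤² R)) h ⟩
    + 1 / 15 * R ^ 2 * (15 * (D ^ 2 * Y))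
      ≡⟨ solve 3 (λ R D Y → con (+ 1 / 15) :* R :^ 2 :* (con 15 :* (D :^ 2 :* Y)) := (D :* R) :^ 2 :* Y) (λ {_ _ _} → refl) R D Y ⟩
    (D * R) ^ 2 * Y
      ≡⟨ cong (λ e → e ^ 2 * Y) (ℕ→ℚ-inverse d {{d≢0}}) ⟩
    1 ^ 2 * Y
      ≡⟨ *-identityˡ Y ⟩
    Y ∎
    where
    open ≤-Reasoning
    n = ℕ→ℚ ℤ.∣ Nα a b d ∣
    D = ℕ→ℚ d
    R = (+ 1 / d) {{d≢0}}
    b⁴n⁴≡ : ℕ→ℚ (b ℕ.^ 4 ℕ.* ℤ.∣ Nα a b d ∣ ℕ.^ 4) ≡ ℕ→ℚ b ^ 4 * n ^ 4
    b⁴n⁴≡ = trans (ℕ→ℚ-homo-* (b ℕ.^ 4) _) (cong₂ _*_ (ℕ→ℚ-homo-^ b 4) (ℕ→ℚ-homo-^ ℤ.∣ Nα a b d ∣ 4))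

  suc-last-exceedance-≤ : ∀ {B} {y : ℤ → ℚ} {K} → y 0ℤ ≤ B → K ℤ.< 0ℤ
    → (∀ j → K ℤ.< j → j ℤ.< 0ℤ → ¬ (B < y j)) → y (ℤ.suc K) ≤ B
  suc-last-exceedance-≤ {K = + n} _ (ℤ.+<+ ()) _
  suc-last-exceedance-≤ {K = -[1+ zero ]} y₀≤B _ _ = y₀≤B
  suc-last-exceedance-≤ {K = -[1+ suc m ]} _ _ last = ≮⇒≥ (last -[1+ m ] (ℤ.-<- (n<1+n m)) ℤ.-<+)

  module OrbitTail {T B D n} (218≤T : 218 ≤ T) (0<B : 0 < B) (0<D : 0 < D) (0≤n : 0 ≤ n)
                   (small-B : 947 * B ^ 9 * D ^ 2 ≤ 100 * (T + 2) ^ 3)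
                   {y : ℤ → ℚ} (rec : Recurrentℤ T y)
                   (disc : ∀ k → (T ^ 2 - 4) * n ≡ 4 * D * Φ T (y k) (y (ℤ.suc k))) where

    forward-tail : y 0ℤ ≤ B → B ≤ y (+ 1) → ∀ i → 64 * (B ^ 2 * n ^ 4) ≤ 15 * (D ^ 2 * y (+ (3 ℕ.+ i)))
    forward-tail y₀≤B B≤y₁ = tail-bound {s = λ i → y (+ i)} 218≤T 0<B 0<D 0≤n small-B
      (recurrent-forward {T} {y} rec) y₀≤B B≤y₁
      (trans (disc 0ℤ) (cong (4 * D *_) (Φ-sym T (y 0ℤ) (y (+ 1)))))

    backward-tail : ∀ K → y (ℤ.suc K) ≤ B → B ≤ y K
      → ∀ i → 64 * (B ^ 2 * n ^ 4) ≤ 15 * (D ^ 2 * y (ℤ.suc K ℤ.- + (3 ℕ.+ i)))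
    backward-tail K yₖ₊₁≤B B≤yₖ = tail-bound {s = λ i → y (ℤ.suc K ℤ.- + i)} 218≤T 0<B 0<D 0≤n small-B
      (recurrent-backward {T} {y} rec (ℤ.suc K))
      (subst (λ j → y j ≤ B) (sym start) yₖ₊₁≤B) (subst (λ j → B ≤ y j) (sym next) B≤yₖ)
      (subst₂ (λ j l → (T ^ 2 - 4) * n ≡ 4 * D * Φ T (y j) (y l)) (sym next) (sym start) (disc K))
      where
      start : ℤ.suc K ℤ.- + 0 ≡ ℤ.suc K
      start = ℤ.+-identityʳ (ℤ.suc K)
      next : ℤ.suc K ℤ.- + 1 ≡ K
      next = trans (ℤ.minus-suc (ℤ.suc K) 0) (trans (cong ℤ.pred start) (ℤ.pred-suc K))

    orbit-tail-bound : y 0ℤ ≤ B → B ≤ y (+ 1) → ∀ K → y (ℤ.suc K) ≤ B → B ≤ y K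
      → ∀ k → + 3 ℤ.≤ k ⊎ k ℤ.≤ K ℤ.- + 2 → 64 * (B ^ 2 * n ^ 4) ≤ 15 * (D ^ 2 * y k)
    orbit-tail-bound y₀≤B B≤y₁ K _ _ k (inj₁ 3≤k) with forward-index 3≤k
    ... | i , refl = forward-tail y₀≤B B≤y₁ i
    orbit-tail-bound _ _ K yₖ₊₁≤B B≤yₖ k (inj₂ k≤K-2) with backward-index {K} k≤K-2
    ... | i , refl = backward-tail K yₖ₊₁≤B B≤yₖ i

open import Defs
open import Data.Nat using (ℕ; _^_; NonZero)
open import Data.Integer using (ℤ; +_; -_; _-_; _<_; _≤_; _≥_; _*_)
open import Data.Rational using (ℚ)
open import Data.Product using (_×_; _,_)
open import Data.Sum using (_⊎_)
open import Relation.Nullary using (¬_)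
open import Relation.Binary.PropositionalEquality using (_≡_; _≢_)
import Data.Nat as N
import Data.Rational as Q

import Data.Integer as ℤ
import Data.Integer.Properties as ℤ
import Data.Nat.Properties as ℕ
open import Data.Rational.Properties using (≤-reflexive; <⇒≤)
open import Data.Product using (proj₂)
open import Relation.Binary.PropositionalEquality using (sym; trans; cong; cong₂; subst; subst₂)
open RationalLemmas
  using (ℕ→ℚ-nonNeg; ℕ→ℚ-pos; norm; mulD-assoc; module Orbit; module UnitSquare; cube-condition-ℚ; ∣Nα∣≡-norm;
         bound-≤; suc-last-exceedance-≤; module OrbitTail)

lemma4p1 : (a b d t u : ℕ) → .{{_ : NonZero a}} → .{{_ : NonZero b}} → .{{_ : NonZero d}}
    → .{{_ : NonZero t}} → .{{_ : NonZero u}}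
    → (∀ (m : ℕ) → m N.* m ≢ d)
    → Nα a b d < + 0
    → (t N.* t ≡ u N.* u N.* d N.+ 4 ⊎ t N.* t N.+ 4 ≡ u N.* u N.* d)
    → (x y : ℤ → ℚ)
    → x (+ 0) ≡ ℕ→ℚ a
    → y (+ 0) ≡ ℕ→ℚ (b ^ 2)
    → (∀ (k : ℤ) → (x (k Data.Integer.+ + 1) , y (k Data.Integer.+ + 1))
                   ≡ mulD d (mulD d (x k , y k) (epsD t u)) (epsD t u))
    → (∀ (k m : ℤ) → y k ≡ ℤ→ℚ (m * m) → ℕ→ℚ (b ^ 2) Q.≤ y k)
    → (K : ℤ) → K < + 0 → ℕ→ℚ (b ^ 2) Q.< y K
    → (∀ (j : ℤ) → K < j → j < + 0 → ¬ (ℕ→ℚ (b ^ 2) Q.< y j))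
    → 201 N.< d
    → 947 N.* (b ^ 18) N.< 100 N.* d N.* (u ^ 6)
    → ∀ (k : ℤ) → (k ≥ + 3 ⊎ k ≤ K - + 2)
    → bound a b d Q.≤ y k
lemma4p1 a b d t u {{_}} {{_}} {{d≢0}} {{_}} {{u≢0}} _ Nα<0 unit x y x₀ y₀ step _ K K<0 B<yK last 201<d small-b k range =
  bound-≤ a b d d≢0
    (orbit-tail-bound (≤-reflexive y₀) B≤y₁ K (suc-last-exceedance-≤ (≤-reflexive y₀) K<0 last) (<⇒≤ B<yK) k range)
  where
  open UnitSquare d t u u≢0 unit using (ε; η; norm-η; 218≤T; u²d≤T+2; y-grows)
  open Orbit d η norm-η using (module Sequence)

  orbit-step : ∀ k → (x (ℤ.suc k) , y (ℤ.suc k)) ≡ mulD d (x k , y k) η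
  orbit-step k = trans (cong (λ j → x j , y j) (ℤ.+-comm (+ 1) k)) (trans (step k) (mulD-assoc d (x k , y k) ε ε))

  open Sequence x y orbit-step using (y-recurrence; discriminant-invariant)

  n≡-norm : ℕ→ℚ ℤ.∣ Nα a b d ∣ ≡ Q.- norm d (x (+ 0) , y (+ 0))
  n≡-norm = trans (∣Nα∣≡-norm a b d Nα<0) (cong₂ (λ p q → Q.- norm d (p , q)) (sym x₀) (sym y₀))

  B≤y₁ : ℕ→ℚ (b ^ 2) Q.≤ y (+ 1)
  B≤y₁ = subst₂ Q._≤_ y₀ (sym (cong proj₂ (orbit-step (+ 0))))
    (y-grows 201<d (subst (Q._≤_ _) (sym x₀) (ℕ→ℚ-nonNeg a)) (subst (Q._≤_ _) (sym y₀) (ℕ→ℚ-nonNeg (b ^ 2))))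

  open OrbitTail (218≤T 201<d) (ℕ→ℚ-pos (b ^ 2) {{ℕ.m^n≢0 b 2}}) (ℕ→ℚ-pos d) (ℕ→ℚ-nonNeg ℤ.∣ Nα a b d ∣)
    (cube-condition-ℚ b d u small-b (u²d≤T+2 201<d)) y-recurrence (discriminant-invariant n≡-norm)
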